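{- Let $x$ be a sturmian word and $m\ge2$. Then $r(x,m)=m+1$ if and only if $r(x,m)\neq r(x,m-1)$.
   Context: A sturmian word is an infinite word over $\{0,1\}$ having exactly $n+1$ distinct factors of length $n$ for every $n\ge1$. $T$ is the shift and $\mathbb{P}_m(x)$ the prefix of length $m$ of $x$. The repetition function $r(x,m)$ is the largest integer $k\ge1$ such that $\mathbb{P}_m(x),\mathbb{P}_m(T(x)),\ldots,\mathbb{P}_m(T^{k-1}(x))$ are pairwise distinct. -}

module Defs where

open import Data.Nat using (ℕ; zero; suc; _+_; _≤_; _<_)
open import Data.Fin using (Fin; toℕ)
open import Data.Bool using (Bool)
open import Data.Product using (Σ; ∃; _×_; _,_)
open import Relation.Binary.PropositionalEquality using (_≡_)
open import Relation.Nullary using (¬_)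

Word : Set
Word = ℕ → Bool

T : Word → Word
T x i = x (suc i)

FinWord : ℕ → Set
FinWord n = Fin n → Bool

-- equality of finite words (pointwise; avoids function extensionality)
_≈w_ : ∀ {n} → FinWord n → FinWord n → Set
u ≈w v = ∀ j → u j ≡ v j

P : (m : ℕ) → Word → FinWord m
P m x j = x (toℕ j)

T^ : ℕ → Word → Word
T^ i x j = x (i + j)

IsFactor : ∀ {n} → Word → FinWord n → Set
IsFactor {n} x u = ∃ λ i → u ≈w P n (T^ i x)

HasFactorCount : Word → (n c : ℕ) → Set
HasFactorCount x n c =
  Σ (Fin c → FinWord n) λ f →
    (∀ a b → f a ≈w f b → a ≡ b) ×
    (∀ a → IsFactor x (f a)) ×
    (∀ (u : FinWord n) → IsFactor x u → ∃ λ a → u ≈w f a)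

Sturmian : Word → Set
Sturmian x = ∀ n → 1 ≤ n → HasFactorCount x n (suc n)

DistinctPrefixes : Word → (m k : ℕ) → Set
DistinctPrefixes x m k =
  ∀ i j → i < k → j < k → P m (T^ i x) ≈w P m (T^ j x) → i ≡ j

-- r(x,m) = k : k is the largest k ≥ 1 with DistinctPrefixes x m k
IsRepetition : Word → (m k : ℕ) → Set
IsRepetition x m k =
  1 ≤ k × DistinctPrefixes x m k × (∀ k′ → DistinctPrefixes x m k′ → k′ ≤ k)

-- Let k′ = r(x,m-1) and k = r(x,m). Counting factors gives k′ ≤ k ≤ m+1, and k = k′ = m+1 is
-- impossible since there are only m factors of length m-1. If k′ < k, the window of length m-1 at
-- k′ repeats an earlier one at i, while the windows of length m at i and k′ still differ: that
-- window is right special, hence the unique right special factor of length m-1 (the factor counts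
-- m, m+1 leave room for only one), and both of its extensions occur before k. By induction on p,
-- every window of length m then occurs before k, so all m+1 factors of length m do and k = m+1.
module Submission where

open import Defs
open import Data.Nat using (ℕ; zero; suc; _+_; _∸_; _≤_; _<_; z≤n; s≤s)
open import Data.Nat.Properties
  using (+-suc; +-comm; ≤-antisym; <-trans; ≤∧≢⇒<; <⇒≢; 1+n≰n; m<1+n⇒m<n∨m≡n; m≤n⇒m<n∨m≡n; anyUpTo?)
open import Data.Fin using (Fin; zero; suc; toℕ; fromℕ<; inject₁; fromℕ)
open import Data.Fin.Properties using (injective⇒≤; toℕ-injective; toℕ<n; toℕ-fromℕ<; toℕ-inject₁; toℕ-fromℕ)
open import Data.Bool using (_≟_)
open import Data.Bool.Properties using (¬-not)
open import Data.Vec.Functional using (_∷_)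
import Data.Vec.Functional.Relation.Binary.Pointwise.Properties as Pointwise
open import Data.Product using (∃; _×_; _,_; proj₁; proj₂)
open import Data.Sum using (_⊎_; inj₁; inj₂)
open import Relation.Nullary using (¬_; Dec; yes; no; contradiction)
open import Relation.Nullary.Decidable using (decidable-stable)
open import Relation.Binary.PropositionalEquality
  using (_≡_; _≢_; refl; sym; trans; cong; subst; ≢-sym)

module _ {n : ℕ} where

  ≈w-refl : {u : FinWord n} → u ≈w u
  ≈w-refl _ = refl

  ≈w-sym : {u v : FinWord n} → u ≈w v → v ≈w u
  ≈w-sym = Pointwise.sym {R = _≡_} sym

  ≈w-trans : {u v w : FinWord n} → u ≈w v → v ≈w w → u ≈w w
  ≈w-trans = Pointwise.trans {R = _≡_} trans

  _≈w?_ : (u v : FinWord n) → Dec (u ≈w v)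
  _≈w?_ = Pointwise.decidable {R = _≡_} _≟_

module _ (x : Word) where

  window : (n s : ℕ) → FinWord n
  window n s = P n (T^ s x)

  module _ {n s t : ℕ} where

    window-init : window (suc n) s ≈w window (suc n) t → window n s ≈w window n t
    window-init e j = subst (λ i → x (s + i) ≡ x (t + i)) (toℕ-inject₁ j) (e (inject₁ j))

    window-last : window (suc n) s ≈w window (suc n) t → x (s + n) ≡ x (t + n)
    window-last e = subst (λ i → x (s + i) ≡ x (t + i)) (toℕ-fromℕ n) (e (fromℕ n))

    window-tail : window (suc n) s ≈w window (suc n) t → window n (suc s) ≈w window n (suc t)
    window-tail e j rewrite sym (+-suc s (toℕ j)) | sym (+-suc t (toℕ j)) = e (Data.Fin.suc j)

    window-snoc : window n s ≈w window n t → x (s + n) ≡ x (t + n) → window (suc n) s ≈w window (suc n) t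
    window-snoc e last j with m<1+n⇒m<n∨m≡n (toℕ<n j)
    ... | inj₁ j<n = subst (λ i → x (s + i) ≡ x (t + i)) (toℕ-fromℕ< j<n) (e (fromℕ< j<n))
    ... | inj₂ j≡n = subst (λ i → x (s + i) ≡ x (t + i)) (sym j≡n) last

  OccursBefore : (n k p : ℕ) → Set
  OccursBefore n k p = ∃ λ j → j < k × window n p ≈w window n j

  RightSpecial : (n s t : ℕ) → Set
  RightSpecial n s t = window n s ≈w window n t × x (s + n) ≢ x (t + n)

  DistinctWindows : ∀ {d} → ℕ → (Fin d → ℕ) → Set
  DistinctWindows n ρ = ∀ a b → window n (ρ a) ≈w window n (ρ b) → a ≡ b

  DistinctWindows-∷ : ∀ {n d o} {ρ : Fin d → ℕ} → (∀ a → ¬ window n o ≈w window n (ρ a)) →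
    DistinctWindows n ρ → DistinctWindows n (o ∷ ρ)
  DistinctWindows-∷ fresh distinct zero    zero    e = refl
  DistinctWindows-∷ fresh distinct zero    (suc b) e = contradiction e (fresh b)
  DistinctWindows-∷ fresh distinct (suc a) zero    e = contradiction (≈w-sym e) (fresh a)
  DistinctWindows-∷ fresh distinct (suc a) (suc b) e = cong suc (distinct a b e)

  distinct≤count : ∀ {n c d} → HasFactorCount x n c → (ρ : Fin d → ℕ) → DistinctWindows n ρ → d ≤ c
  distinct≤count {n} (f , _ , _ , complete) ρ distinct = injective⇒≤ index-injective
    where
      index : ∀ a → ∃ λ i → window n (ρ a) ≈w f i
      index a = complete (window n (ρ a)) (ρ a , ≈w-refl)

      index-injective : ∀ {a b} → proj₁ (index a) ≡ proj₁ (index b) → a ≡ b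
      index-injective {a} {b} eq =
        distinct a b (≈w-trans (proj₂ (index a)) λ j → trans (cong (λ i → f i j) eq) (sym (proj₂ (index b) j)))

  count≤positions : ∀ {n c k} → HasFactorCount x n c → (∀ p → OccursBefore n k p) → c ≤ k
  count≤positions {n} {c} {k} (f , unique , factor , _) occurs = injective⇒≤ position-injective
    where
      position : ∀ a → ∃ λ (j : Fin k) → f a ≈w window n (toℕ j)
      position a with factor a
      ... | s , fa≈s with occurs s
      ... | j , j<k , s≈j = fromℕ< j<k , ≈w-trans fa≈s (subst (λ i → window n s ≈w window n i) (sym (toℕ-fromℕ< j<k)) s≈j)

      position-injective : ∀ {a b} → proj₁ (position a) ≡ proj₁ (position b) → a ≡ b
      position-injective {a} {b} eq =
        unique a b (≈w-trans (proj₂ (position a)) λ j → trans (cong (λ i → window n (toℕ i) j) eq) (sym (proj₂ (position b) j)))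

  DistinctPrefixes⇒≤count : ∀ {n c d} → HasFactorCount x n c → DistinctPrefixes x n d → d ≤ c
  DistinctPrefixes⇒≤count count distinct =
    distinct≤count count toℕ λ a b e → toℕ-injective (distinct (toℕ a) (toℕ b) (toℕ<n a) (toℕ<n b) e)

  DistinctPrefixes-suc-length : ∀ {n k} → DistinctPrefixes x n k → DistinctPrefixes x (suc n) k
  DistinctPrefixes-suc-length distinct i j i<k j<k e = distinct i j i<k j<k (window-init e)

  DistinctPrefixes-extend : ∀ {n k} → DistinctPrefixes x n k → ¬ OccursBefore n k k → DistinctPrefixes x n (suc k)
  DistinctPrefixes-extend distinct fresh i j i<1+k j<1+k e with m<1+n⇒m<n∨m≡n i<1+k | m<1+n⇒m<n∨m≡n j<1+k
  ... | inj₁ i<k  | inj₁ j<k  = distinct i j i<k j<k e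
  ... | inj₁ i<k  | inj₂ refl = contradiction (i , i<k , ≈w-sym e) fresh
  ... | inj₂ refl | inj₁ j<k  = contradiction (j , j<k , e) fresh
  ... | inj₂ refl | inj₂ refl = refl

  repetition-occursBefore : ∀ {n k} → IsRepetition x n k → OccursBefore n k k
  repetition-occursBefore {n} {k} (_ , distinct , maximal) with anyUpTo? (λ j → window n k ≈w? window n j) k
  ... | yes occurs = occurs
  ... | no fresh = contradiction (maximal (suc k) (DistinctPrefixes-extend distinct fresh)) 1+n≰n

  repetition-mono : ∀ {n k k′} → IsRepetition x n k′ → IsRepetition x (suc n) k → k′ ≤ k
  repetition-mono (_ , distinct′ , _) (_ , _ , maximal) = maximal _ (DistinctPrefixes-suc-length distinct′)

  repetition≤count : ∀ {n c k} → HasFactorCount x n c → IsRepetition x n k → k ≤ c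
  repetition≤count count (_ , distinct , _) = DistinctPrefixes⇒≤count count distinct

  rightSpecial-avoids : ∀ {n s t} → RightSpecial n s t → ∀ b → ∃ λ o → window n o ≈w window n s × x (o + n) ≢ b
  rightSpecial-avoids {n} {s} {t} (s≈t , s≢t) b with x (s + n) ≟ b
  ... | yes s≡b = t , ≈w-sym s≈t , λ t≡b → s≢t (trans s≡b (sym t≡b))
  ... | no s≢b  = s , ≈w-refl , s≢b

  -- Otherwise the c factors of length n together with one new extension of each right special
  -- factor would be c + 2 distinct factors of length n + 1.
  rightSpecial-unique : ∀ {n c s₁ t₁ s₂ t₂} → HasFactorCount x n c → HasFactorCount x (suc n) (suc c) →
    RightSpecial n s₁ t₁ → RightSpecial n s₂ t₂ → window n s₁ ≈w window n s₂
  rightSpecial-unique {n} {c} {s₁} {_} {s₂} (g , g-unique , g-factor , g-complete) count′ rs₁ rs₂ =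
    decidable-stable (window n s₁ ≈w? window n s₂) λ s₁≉s₂ →
      1+n≰n (distinct≤count count′ (o₁ ∷ o₂ ∷ q) (DistinctWindows-∷ (fresh₁ s₁≉s₂) (DistinctWindows-∷ fresh₂ q-distinct)))
    where
      q : Fin c → ℕ
      q a = proj₁ (g-factor a)

      q-distinct : DistinctWindows (suc n) q
      q-distinct a b e = g-unique a b (≈w-trans (proj₂ (g-factor a)) (≈w-trans (window-init e) (≈w-sym (proj₂ (g-factor b)))))

      newExtension : ∀ {s t} → RightSpecial n s t →
        ∃ λ o → window n o ≈w window n s × ∀ a → ¬ window (suc n) o ≈w window (suc n) (q a)
      newExtension {s} rs with g-complete (window n s) (s , ≈w-refl)
      ... | b , s≈b with rightSpecial-avoids rs (x (q b + n))
      ... | o , o≈s , o≢b = o , o≈s , λ a e →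
        o≢b (subst (λ a → x (o + n) ≡ x (q a + n))
                   (g-unique a b (≈w-trans (proj₂ (g-factor a)) (≈w-trans (≈w-sym (window-init e)) (≈w-trans o≈s s≈b))))
                   (window-last e))

      o₁ o₂ : ℕ
      o₁ = proj₁ (newExtension rs₁)
      o₂ = proj₁ (newExtension rs₂)

      fresh₂ : ∀ a → ¬ window (suc n) o₂ ≈w window (suc n) (q a)
      fresh₂ = proj₂ (proj₂ (newExtension rs₂))

      fresh₁ : ¬ window n s₁ ≈w window n s₂ → ∀ a → ¬ window (suc n) o₁ ≈w window (suc n) ((o₂ ∷ q) a)
      fresh₁ s₁≉s₂ zero e = s₁≉s₂
        (≈w-trans (≈w-sym (proj₁ (proj₂ (newExtension rs₁)))) (≈w-trans (window-init e) (proj₁ (proj₂ (newExtension rs₂)))))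
      fresh₁ _ (suc a) = proj₂ (proj₂ (newExtension rs₁)) a

  rightSpecial-extension : ∀ {n i t p} → RightSpecial n i t → window n p ≈w window n i →
    window (suc n) p ≈w window (suc n) i ⊎ window (suc n) p ≈w window (suc n) t
  rightSpecial-extension {n} {i} {t} {p} (i≈t , i≢t) p≈i with x (p + n) ≟ x (i + n)
  ... | yes p≡i = inj₁ (window-snoc p≈i p≡i)
  ... | no p≢i  = inj₂ (window-snoc (≈w-trans p≈i i≈t) (trans (¬-not p≢i) (sym (¬-not (≢-sym i≢t)))))

  occursBefore-suc-length : ∀ {n c k i t} → HasFactorCount x n c → HasFactorCount x (suc n) (suc c) →
    i < k → t < k → RightSpecial n i t → ∀ {p} → OccursBefore n k p → OccursBefore (suc n) k p
  occursBefore-suc-length {n} count count′ i<k t<k rs {p} (v , v<k , p≈v) with x (p + n) ≟ x (v + n)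
  ... | yes p≡v = v , v<k , window-snoc p≈v p≡v
  ... | no p≢v with rightSpecial-extension rs (≈w-trans p≈v (rightSpecial-unique count count′ (≈w-sym p≈v , ≢-sym p≢v) rs))
  ... | inj₁ p≈i = _ , i<k , p≈i
  ... | inj₂ p≈t = _ , t<k , p≈t

  occursBefore-shift : ∀ {n k p} → OccursBefore (suc n) k k → OccursBefore (suc n) k p → OccursBefore n k (suc p)
  occursBefore-shift (j₀ , j₀<k , k≈j₀) (j , j<k , p≈j) with m≤n⇒m<n∨m≡n j<k
  ... | inj₁ 1+j<k = suc j , 1+j<k , window-tail p≈j
  ... | inj₂ refl  = j₀ , j₀<k , ≈w-trans (window-tail p≈j) (window-init k≈j₀)

  occursBefore-all : ∀ {n k} → 1 ≤ k → OccursBefore (suc n) k k →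
    (∀ {p} → OccursBefore n k p → OccursBefore (suc n) k p) → ∀ p → OccursBefore (suc n) k p
  occursBefore-all 1≤k _   _      zero    = zero , 1≤k , ≈w-refl
  occursBefore-all 1≤k rep extend (suc p) = extend (occursBefore-shift rep (occursBefore-all 1≤k rep extend p))

  repetition-rightSpecial : ∀ {n k k′} → IsRepetition x n k′ → IsRepetition x (suc n) k → k′ < k →
    ∃ λ i → i < k × RightSpecial n i k′
  repetition-rightSpecial {n} {k} {k′} rep′ (_ , distinct , _) k′<k with repetition-occursBefore rep′
  ... | i , i<k′ , k′≈i = i , i<k , ≈w-sym k′≈i , i≢k′
    where
      i<k : i < k
      i<k = <-trans i<k′ k′<k

      i≢k′ : x (i + n) ≢ x (k′ + n)
      i≢k′ i≡k′ = <⇒≢ i<k′ (distinct i k′ i<k k′<k (window-snoc (≈w-sym k′≈i) i≡k′))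

  repetition-jump : ∀ {n c k k′} → HasFactorCount x n c → HasFactorCount x (suc n) (suc c) →
    IsRepetition x n k′ → IsRepetition x (suc n) k → k′ < k → k ≡ suc c
  repetition-jump count count′ rep′ rep@(1≤k , _ , _) k′<k with repetition-rightSpecial rep′ rep k′<k
  ... | i , i<k , rs = ≤-antisym (repetition≤count count′ rep) (count≤positions count′ (occursBefore-all 1≤k
        (repetition-occursBefore rep) (occursBefore-suc-length count count′ i<k k′<k rs)))

mainTheorem9 : (x : Word) → Sturmian x → (m : ℕ) → 2 ≤ m →
    (k k′ : ℕ) → IsRepetition x m k → IsRepetition x (m ∸ 1) k′ →
    (k ≡ m + 1 → k ≢ k′) × (k ≢ k′ → k ≡ m + 1)
mainTheorem9 x sturmian (suc (suc n)) (s≤s (s≤s z≤n)) k k′ rep rep′ = jump⇒≢ , ≢⇒jump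
  where
    count : HasFactorCount x (suc n) (suc (suc n))
    count = sturmian (suc n) (s≤s z≤n)

    count′ : HasFactorCount x (suc (suc n)) (suc (suc (suc n)))
    count′ = sturmian (suc (suc n)) (s≤s z≤n)

    m+1≡3+n : suc (suc n) + 1 ≡ suc (suc (suc n))
    m+1≡3+n = +-comm (suc (suc n)) 1

    jump⇒≢ : k ≡ suc (suc n) + 1 → k ≢ k′
    jump⇒≢ k≡m+1 k≡k′ =
      1+n≰n (subst (_≤ suc (suc n)) (trans (sym k≡k′) (trans k≡m+1 m+1≡3+n)) (repetition≤count x count rep′))

    ≢⇒jump : k ≢ k′ → k ≡ suc (suc n) + 1
    ≢⇒jump k≢k′ =
      trans (repetition-jump x count count′ rep′ rep (≤∧≢⇒< (repetition-mono x rep′ rep) (≢-sym k≢k′))) (sym m+1≡3+n)
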